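{- Let $n\in\mathbb{N}$ and $k\in[n]$. For $\mathbf{x}=(x_1,\ldots,x_{n+1})\in\mathrm{PF}^\uparrow_{n+1,n+1}$ with $x_{n+1}\le k$, let $i=\max F(\mathbf{x})$ and set \[\psi(\mathbf{x})=(\mathbf{x}',i),\qquad \mathbf{x}'=(x_1,\ldots,x_{i-1},x_{i+1},x_{i+2},\ldots,x_{n+1}).\] Then $\psi$ is a bijection from $\{\mathbf{x}\in\mathrm{PF}^\uparrow_{n+1,n+1}:x_{n+1}\le k\}$ to $\{(\mathbf{x}',j)\in M_n: x'_n\le k\}$. Moreover, $F(\mathbf{x})=\{j\in F(\mathbf{x}')\mid j\le i\}$.
   Context: $\mathrm{PF}^\uparrow_{n,n}$ is the set of nondecreasing parking functions of length $n$, i.e. nondecreasing $\mathbf{x}=(x_1,\ldots,x_n)$ of positive integers with $x_j\le j$ for all $j\in[n]$ (equivalently, nondecreasing preference lists with which all $n$ cars park in spots $1,\ldots,n$ under the classical parking scheme). The fixed set is $F(\mathbf{x})=\{j\in[n]: x_j=j\}$ (nonempty since $x_1=1$). The fixed pair set is $M_n=\{(\mathbf{x},j):\mathbf{x}\in\mathrm{PF}^\uparrow_{n,n},\ j\in F(\mathbf{x})\}$. -}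

module Defs where

open import Data.Nat using (ℕ; zero; suc; _≤_; _≟_)
open import Data.Vec using (Vec; []; _∷_)
open import Data.Product using (_×_; Σ; _,_; proj₁)
open import Relation.Binary.PropositionalEquality using (_≡_)
open import Relation.Nullary using (yes; no)

-- 1-based entry access: x ! j = x_j for 1 ≤ j ≤ n, and 0 otherwise.
_!_ : ∀ {n} → Vec ℕ n → ℕ → ℕ
[] ! j = 0
(a ∷ xs) ! zero = 0
(a ∷ xs) ! suc zero = a
(a ∷ xs) ! suc (suc j) = xs ! suc j

IsNDPF : ∀ {n} → Vec ℕ n → Set
IsNDPF {n} x =
  (∀ i j → 1 ≤ i → i ≤ j → j ≤ n → x ! i ≤ x ! j) ×
  (∀ j → 1 ≤ j → j ≤ n → (1 ≤ x ! j) × (x ! j ≤ j))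

IsFixed : ∀ {n} → Vec ℕ n → ℕ → Set
IsFixed {n} x j = (1 ≤ j) × (j ≤ n) × (x ! j ≡ j)

-- largest j ≤ m with x_j = j (0 if none)
maxFixUpTo : ∀ {n} → Vec ℕ n → ℕ → ℕ
maxFixUpTo x zero = 0
maxFixUpTo x (suc j) with x ! suc j ≟ suc j
... | yes _ = suc j
... | no _ = maxFixUpTo x j

maxFix : ∀ {n} → Vec ℕ n → ℕ
maxFix {n} x = maxFixUpTo x n

-- delete the i-th entry (1-based; i = 0 treated like 1, out of range deletes last)
deleteAt : ∀ {n} → ℕ → Vec ℕ (suc n) → Vec ℕ n
deleteAt zero (a ∷ xs) = xs
deleteAt (suc zero) (a ∷ xs) = xs
deleteAt {zero} (suc (suc i)) (a ∷ []) = []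
deleteAt {suc n} (suc (suc i)) (a ∷ xs) = a ∷ deleteAt (suc i) xs

ψ : ∀ {n} → Vec ℕ (suc n) → Vec ℕ n × ℕ
ψ x = deleteAt (maxFix x) x , maxFix x

InDom : (n k : ℕ) → Vec ℕ (suc n) → Set
InDom n k x = IsNDPF x × (x ! suc n ≤ k)

InCod : (n k : ℕ) → Vec ℕ n × ℕ → Set
InCod n k (x' , j) = IsNDPF x' × IsFixed x' j × (x' ! n ≤ k)

{-# OPTIONS --safe #-}
-- Deleting the i-th entry of a vector precomposes it with the monotone index map punchIn i, and duplicating
-- its j-th entry precomposes it with the monotone map collapse j (the coface and codegeneracy maps of the
-- simplex category), so both operations preserve monotonicity. For i = max F(x) we have i ≤ n because
-- x_{n+1} ≤ k ≤ n, hence x_{i+1} = x_i = i: deleting x_i keeps i fixed, the bound x'_l ≤ l above i comes from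
-- x_{l+1} < l+1, and the entries of x' up to i are those of x, which gives the fixed sets. Conversely,
-- inserting j at a fixed point j of x' duplicates x'_j and creates no fixed point above j, so ψ undoes it.
module Submission where

open import Defs
open import Data.Nat using (ℕ; zero; suc; pred; _≤_; _<_; _≟_; z≤n; s≤s; s≤s⁻¹)
open import Data.Nat.Properties
  using (≤-refl; ≤-trans; ≤-antisym; ≤-reflexive; n≤1+n; m≤n⇒m≤1+n; <⇒≤; ≮⇒≥; ≤∧≢⇒<;
         <⇒≱; 1+n≰n; pred-mono-≤; m≤n⇒m<n∨m≡n; _<?_; module ≤-Reasoning)
open import Data.Vec using (Vec; []; _∷_)
open import Data.Product using (_×_; Σ; _,_; proj₁; proj₂; uncurry)
open import Data.Sum using (inj₁; inj₂)
open import Data.Empty using (⊥-elim)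
open import Function.Bundles using (_⇔_; mk⇔; Equivalence)
open import Relation.Binary.Core using (_Preserves_⟶_)
open import Relation.Nullary using (yes; no)
open import Relation.Binary.PropositionalEquality using (_≡_; _≢_; refl; sym; trans; cong; subst; module ≡-Reasoning)

punchIn : ℕ → ℕ → ℕ
punchIn zero    l       = suc l
punchIn (suc i) zero    = zero
punchIn (suc i) (suc l) = suc (punchIn i l)

punchIn-mono : ∀ i → punchIn i Preserves _≤_ ⟶ _≤_
punchIn-mono zero    a≤b       = s≤s a≤b
punchIn-mono (suc i) z≤n       = z≤n
punchIn-mono (suc i) (s≤s a≤b) = s≤s (punchIn-mono i a≤b)

≤-punchIn : ∀ i l → l ≤ punchIn i l
≤-punchIn zero    l       = n≤1+n l
≤-punchIn (suc i) zero    = z≤n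
≤-punchIn (suc i) (suc l) = s≤s (≤-punchIn i l)

punchIn-≤-suc : ∀ i l → punchIn i l ≤ suc l
punchIn-≤-suc zero    l       = ≤-refl
punchIn-≤-suc (suc i) zero    = z≤n
punchIn-≤-suc (suc i) (suc l) = s≤s (punchIn-≤-suc i l)

punchIn-below : ∀ {i l} → l < i → punchIn i l ≡ l
punchIn-below {suc i} {zero}  _         = refl
punchIn-below {suc i} {suc l} (s≤s l<i) = cong suc (punchIn-below l<i)

punchIn-above : ∀ {i l} → i ≤ l → punchIn i l ≡ suc l
punchIn-above {zero}          _         = refl
punchIn-above {suc i} {suc l} (s≤s i≤l) = cong suc (punchIn-above i≤l)

collapse : ℕ → ℕ → ℕ
collapse zero    l       = pred l
collapse (suc j) zero    = zero
collapse (suc j) (suc l) = suc (collapse j l)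

collapse-mono : ∀ j → collapse j Preserves _≤_ ⟶ _≤_
collapse-mono zero    a≤b       = pred-mono-≤ a≤b
collapse-mono (suc j) z≤n       = z≤n
collapse-mono (suc j) (s≤s a≤b) = s≤s (collapse-mono j a≤b)

collapse-≤ : ∀ j l → collapse j l ≤ l
collapse-≤ zero    zero    = z≤n
collapse-≤ zero    (suc l) = n≤1+n l
collapse-≤ (suc j) zero    = z≤n
collapse-≤ (suc j) (suc l) = s≤s (collapse-≤ j l)

collapse-positive : ∀ {j l} → 1 ≤ j → 1 ≤ l → 1 ≤ collapse j l
collapse-positive {suc j} {suc l} _ _ = s≤s z≤n

collapse-below : ∀ {j l} → l ≤ j → collapse j l ≡ l
collapse-below {zero}  z≤n       = refl
collapse-below {suc j} z≤n       = refl
collapse-below {suc j} (s≤s l≤j) = cong suc (collapse-below l≤j)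

collapse-above : ∀ {j m} → j ≤ m → collapse j (suc m) ≡ m
collapse-above {zero}          _         = refl
collapse-above {suc j} {suc m} (s≤s j≤m) = cong suc (collapse-above j≤m)

deleteAt-! : ∀ {n} i (x : Vec ℕ (suc n)) l → 1 ≤ l → l ≤ n → deleteAt i x ! l ≡ x ! punchIn i l
deleteAt-! zero          (a ∷ b ∷ xs) (suc zero)    _ _         = refl
deleteAt-! zero          (a ∷ b ∷ xs) (suc (suc l)) _ _         = refl
deleteAt-! (suc zero)    (a ∷ b ∷ xs) (suc zero)    _ _         = refl
deleteAt-! (suc zero)    (a ∷ b ∷ xs) (suc (suc l)) _ _         = refl
deleteAt-! (suc (suc i)) (a ∷ b ∷ xs) (suc zero)    _ _         = refl
deleteAt-! (suc (suc i)) (a ∷ b ∷ xs) (suc (suc l)) _ (s≤s l≤n) = deleteAt-! (suc i) (b ∷ xs) (suc l) (s≤s z≤n) l≤n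

-- As for deleteAt, positions are 1-based, 0 acts as 1, and an out-of-range position appends.
insertAt : ∀ {A : Set} {n} → ℕ → A → Vec A n → Vec A (suc n)
insertAt zero          v xs       = v ∷ xs
insertAt (suc zero)    v xs       = v ∷ xs
insertAt (suc (suc i)) v []       = v ∷ []
insertAt (suc (suc i)) v (a ∷ xs) = a ∷ insertAt (suc i) v xs

insertAt-copy-! : ∀ {n} j (x : Vec ℕ n) l → 1 ≤ j → j ≤ n → insertAt j (x ! j) x ! l ≡ x ! collapse j l
insertAt-copy-! (suc zero)    (a ∷ xs) zero          _ _         = refl
insertAt-copy-! (suc zero)    (a ∷ xs) (suc zero)    _ _         = refl
insertAt-copy-! (suc zero)    (a ∷ xs) (suc (suc l)) _ _         = refl
insertAt-copy-! (suc (suc j)) (a ∷ xs) zero          _ _         = refl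
insertAt-copy-! (suc (suc j)) (a ∷ xs) (suc zero)    _ _         = refl
insertAt-copy-! (suc (suc j)) (a ∷ xs) (suc (suc l)) _ (s≤s j<n) =
  insertAt-copy-! (suc j) xs (suc l) (s≤s z≤n) j<n

deleteAt-insertAt : ∀ {n} i v (x : Vec ℕ n) → deleteAt i (insertAt i v x) ≡ x
deleteAt-insertAt zero          v x        = refl
deleteAt-insertAt (suc zero)    v x        = refl
deleteAt-insertAt (suc (suc i)) v []       = refl
deleteAt-insertAt (suc (suc i)) v (a ∷ xs) = cong (a ∷_) (deleteAt-insertAt (suc i) v xs)

insertAt-deleteAt : ∀ {n} i (x : Vec ℕ (suc n)) → 1 ≤ i → i ≤ suc n → insertAt i (x ! i) (deleteAt i x) ≡ x
insertAt-deleteAt (suc zero)    (a ∷ xs)     _ _         = refl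
insertAt-deleteAt (suc (suc i)) (a ∷ b ∷ xs) _ (s≤s i<n) =
  cong (a ∷_) (insertAt-deleteAt (suc i) (b ∷ xs) (s≤s z≤n) i<n)

isNDPF-reindex : ∀ {m n} (x : Vec ℕ m) (y : Vec ℕ n) (f : ℕ → ℕ) →
  f Preserves _≤_ ⟶ _≤_ →
  (∀ l → 1 ≤ l → l ≤ n → 1 ≤ f l × f l ≤ m) →
  (∀ l → 1 ≤ l → l ≤ n → y ! l ≡ x ! f l) →
  (∀ l → 1 ≤ l → l ≤ n → x ! f l ≤ l) →
  IsNDPF x → IsNDPF y
isNDPF-reindex {m} {n} x y f f-mono f-range y≡x∘f x∘f≤id (x-mono , x-bounds) = y-mono , y-bounds
  where
  y-mono : ∀ a b → 1 ≤ a → a ≤ b → b ≤ n → y ! a ≤ y ! b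
  y-mono a b 1≤a a≤b b≤n = begin
    y ! a   ≡⟨ y≡x∘f a 1≤a (≤-trans a≤b b≤n) ⟩
    x ! f a ≤⟨ x-mono (f a) (f b) (proj₁ (f-range a 1≤a (≤-trans a≤b b≤n))) (f-mono a≤b)
                      (proj₂ (f-range b (≤-trans 1≤a a≤b) b≤n)) ⟩
    x ! f b ≡⟨ sym (y≡x∘f b (≤-trans 1≤a a≤b) b≤n) ⟩
    y ! b   ∎
    where open ≤-Reasoning

  y-bounds : ∀ l → 1 ≤ l → l ≤ n → (1 ≤ y ! l) × (y ! l ≤ l)
  y-bounds l 1≤l l≤n rewrite y≡x∘f l 1≤l l≤n =
    proj₁ (x-bounds (f l) (proj₁ (f-range l 1≤l l≤n)) (proj₂ (f-range l 1≤l l≤n))) , x∘f≤id l 1≤l l≤n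

IsLastFixed : ∀ {n} → Vec ℕ n → ℕ → Set
IsLastFixed {n} x i = IsFixed x i × (∀ l → i < l → l ≤ n → x ! l ≢ l)

fixed-≤-maxFixUpTo : ∀ {n} (x : Vec ℕ n) m {l} → 1 ≤ l → l ≤ m → x ! l ≡ l → l ≤ maxFixUpTo x m
fixed-≤-maxFixUpTo x zero    (s≤s _) ()
fixed-≤-maxFixUpTo x (suc m) {l} 1≤l l≤m xₗ≡l with x ! suc m ≟ suc m | m≤n⇒m<n∨m≡n l≤m
... | yes _   | _          = l≤m
... | no _    | inj₁ l<1+m = fixed-≤-maxFixUpTo x m 1≤l (s≤s⁻¹ l<1+m) xₗ≡l
... | no x≢ₘm | inj₂ refl  = ⊥-elim (x≢ₘm xₗ≡l)

maxFixUpTo-least : ∀ {n} (x : Vec ℕ n) m {j} → (∀ l → 1 ≤ l → l ≤ m → x ! l ≡ l → l ≤ j) → maxFixUpTo x m ≤ j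
maxFixUpTo-least x zero    _       = z≤n
maxFixUpTo-least x (suc m) fixed≤j with x ! suc m ≟ suc m
... | yes xₘ≡m = fixed≤j (suc m) (s≤s z≤n) ≤-refl xₘ≡m
... | no _     = maxFixUpTo-least x m (λ l 1≤l l≤m → fixed≤j l 1≤l (m≤n⇒m≤1+n l≤m))

maxFixUpTo-fixed : ∀ {n} (x : Vec ℕ n) m → 1 ≤ maxFixUpTo x m → x ! maxFixUpTo x m ≡ maxFixUpTo x m
maxFixUpTo-fixed x (suc m) 1≤i with x ! suc m ≟ suc m
... | yes xₘ≡m = xₘ≡m
... | no _     = maxFixUpTo-fixed x m 1≤i

maxFix-isLastFixed : ∀ {n} (x : Vec ℕ n) {j} → IsFixed x j → IsLastFixed x (maxFix x)
maxFix-isLastFixed {n} x (1≤j , j≤n , xⱼ≡j) = (1≤i , i≤n , maxFixUpTo-fixed x n 1≤i) , above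
  where
  1≤i : 1 ≤ maxFix x
  1≤i = ≤-trans 1≤j (fixed-≤-maxFixUpTo x n 1≤j j≤n xⱼ≡j)

  i≤n : maxFix x ≤ n
  i≤n = maxFixUpTo-least x n (λ _ _ l≤n _ → l≤n)

  above : ∀ l → maxFix x < l → l ≤ n → x ! l ≢ l
  above l i<l l≤n xₗ≡l = <⇒≱ i<l (fixed-≤-maxFixUpTo x n (≤-trans 1≤i (<⇒≤ i<l)) l≤n xₗ≡l)

isLastFixed⇒maxFix≡ : ∀ {n} (x : Vec ℕ n) {i} → IsLastFixed x i → maxFix x ≡ i
isLastFixed⇒maxFix≡ {n} x ((1≤i , i≤n , xᵢ≡i) , above) =
  ≤-antisym (maxFixUpTo-least x n (λ l _ l≤n xₗ≡l → ≮⇒≥ (λ i<l → above l i<l l≤n xₗ≡l)))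
            (fixed-≤-maxFixUpTo x n 1≤i i≤n xᵢ≡i)

isNDPF-fixed-1 : ∀ {n} (x : Vec ℕ (suc n)) → IsNDPF x → IsFixed x 1
isNDPF-fixed-1 x (_ , bounds) with bounds 1 ≤-refl (s≤s z≤n)
... | 1≤x₁ , x₁≤1 = ≤-refl , s≤s z≤n , ≤-antisym x₁≤1 1≤x₁

isNDPF-unfixed-< : ∀ {n} (x : Vec ℕ n) {l} → IsNDPF x → 1 ≤ l → l ≤ n → x ! l ≢ l → x ! l < l
isNDPF-unfixed-< x (_ , bounds) 1≤l l≤n xₗ≢l = ≤∧≢⇒< (proj₂ (bounds _ 1≤l l≤n)) xₗ≢l

isNDPF-lastFixed-suc : ∀ {n} (x : Vec ℕ n) {i} → IsNDPF x → IsLastFixed x i → i < n → x ! suc i ≡ i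
isNDPF-lastFixed-suc x {i} ndpf ((1≤i , _ , xᵢ≡i) , above) i<n =
  ≤-antisym (s≤s⁻¹ (isNDPF-unfixed-< x ndpf (s≤s z≤n) i<n (above (suc i) ≤-refl i<n)))
            (subst (_≤ x ! suc i) xᵢ≡i (proj₁ ndpf i (suc i) 1≤i (n≤1+n i) i<n))

inDom-lastFixed : ∀ {n k} (x : Vec ℕ (suc n)) → k ≤ n → InDom n k x → IsLastFixed x (maxFix x) × maxFix x ≤ n
inDom-lastFixed {n} {k} x k≤n (ndpf , xₙ₊₁≤k) = last , s≤s⁻¹ (≤∧≢⇒< i≤1+n i≢1+n)
  where
  last : IsLastFixed x (maxFix x)
  last = maxFix-isLastFixed x (isNDPF-fixed-1 x ndpf)

  i≤1+n : maxFix x ≤ suc n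
  i≤1+n = proj₁ (proj₂ (proj₁ last))

  i≢1+n : maxFix x ≢ suc n
  i≢1+n i≡1+n = 1+n≰n (begin
    suc n      ≡⟨ sym (subst (λ t → x ! t ≡ t) i≡1+n (proj₂ (proj₂ (proj₁ last)))) ⟩
    x ! suc n  ≤⟨ xₙ₊₁≤k ⟩
    k          ≤⟨ k≤n ⟩
    n          ∎)
    where open ≤-Reasoning

module _ {n} (x : Vec ℕ (suc n)) {i} (ndpf : IsNDPF x) (last : IsLastFixed x i) where

  deleteAt-lastFixed-isNDPF : IsNDPF (deleteAt i x)
  deleteAt-lastFixed-isNDPF =
    isNDPF-reindex x (deleteAt i x) (punchIn i) (punchIn-mono i) range (deleteAt-! i x) bound ndpf
    where
    range : ∀ l → 1 ≤ l → l ≤ n → 1 ≤ punchIn i l × punchIn i l ≤ suc n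
    range l 1≤l l≤n = ≤-trans 1≤l (≤-punchIn i l) , ≤-trans (punchIn-≤-suc i l) (s≤s l≤n)

    bound : ∀ l → 1 ≤ l → l ≤ n → x ! punchIn i l ≤ l
    bound l 1≤l l≤n with l <? i
    ... | yes l<i rewrite punchIn-below l<i = proj₂ (proj₂ ndpf l 1≤l (m≤n⇒m≤1+n l≤n))
    ... | no l≮i rewrite punchIn-above (≮⇒≥ l≮i) =
      s≤s⁻¹ (isNDPF-unfixed-< x ndpf (s≤s z≤n) (s≤s l≤n) (proj₂ last (suc l) (s≤s (≮⇒≥ l≮i)) (s≤s l≤n)))

  deleteAt-lastFixed-! : i ≤ n → ∀ {l} → 1 ≤ l → l ≤ i → deleteAt i x ! l ≡ x ! l
  deleteAt-lastFixed-! i≤n {l} 1≤l l≤i with m≤n⇒m<n∨m≡n l≤i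
  ... | inj₁ l<i = trans (deleteAt-! i x l 1≤l (≤-trans l≤i i≤n)) (cong (x !_) (punchIn-below l<i))
  ... | inj₂ refl = begin
    deleteAt l x ! l ≡⟨ deleteAt-! l x l 1≤l i≤n ⟩
    x ! punchIn l l  ≡⟨ cong (x !_) (punchIn-above ≤-refl) ⟩
    x ! suc l        ≡⟨ isNDPF-lastFixed-suc x ndpf last (s≤s i≤n) ⟩
    l                ≡⟨ sym (proj₂ (proj₂ (proj₁ last))) ⟩
    x ! l            ∎
    where open ≡-Reasoning

  deleteAt-lastFixed-isFixed : i ≤ n → ∀ j → IsFixed x j ⇔ (IsFixed (deleteAt i x) j × j ≤ i)
  deleteAt-lastFixed-isFixed i≤n j = mk⇔ to from
    where
    to : IsFixed x j → IsFixed (deleteAt i x) j × j ≤ i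
    to (1≤j , j≤1+n , xⱼ≡j) = (1≤j , ≤-trans j≤i i≤n , trans (deleteAt-lastFixed-! i≤n 1≤j j≤i) xⱼ≡j) , j≤i
      where
      j≤i : j ≤ i
      j≤i = ≮⇒≥ (λ i<j → proj₂ last j i<j j≤1+n xⱼ≡j)

    from : IsFixed (deleteAt i x) j × j ≤ i → IsFixed x j
    from ((1≤j , j≤n , x'ⱼ≡j) , j≤i) = 1≤j , m≤n⇒m≤1+n j≤n , trans (sym (deleteAt-lastFixed-! i≤n 1≤j j≤i)) x'ⱼ≡j

module _ {n} (x : Vec ℕ n) {j} (ndpf : IsNDPF x) (fixed : IsFixed x j) where

  private
    1≤j : 1 ≤ j
    1≤j = proj₁ fixed

    j≤n : j ≤ n
    j≤n = proj₁ (proj₂ fixed)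

    insertAt-fixed-! : ∀ l → insertAt j j x ! l ≡ x ! collapse j l
    insertAt-fixed-! l =
      subst (λ v → insertAt j v x ! l ≡ x ! collapse j l) (proj₂ (proj₂ fixed)) (insertAt-copy-! j x l 1≤j j≤n)

    x≤id : ∀ m → 1 ≤ m → m ≤ n → x ! m ≤ m
    x≤id m 1≤m m≤n = proj₂ (proj₂ ndpf m 1≤m m≤n)

  insertAt-fixed-isNDPF : IsNDPF (insertAt j j x)
  insertAt-fixed-isNDPF =
    isNDPF-reindex x (insertAt j j x) (collapse j) (collapse-mono j) range (λ l _ _ → insertAt-fixed-! l) bound ndpf
    where
    range : ∀ l → 1 ≤ l → l ≤ suc n → 1 ≤ collapse j l × collapse j l ≤ n
    range l 1≤l l≤1+n =
      collapse-positive 1≤j 1≤l , ≤-trans (collapse-mono j l≤1+n) (≤-reflexive (collapse-above j≤n))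

    bound : ∀ l → 1 ≤ l → l ≤ suc n → x ! collapse j l ≤ l
    bound l 1≤l l≤1+n = ≤-trans (uncurry (x≤id (collapse j l)) (range l 1≤l l≤1+n)) (collapse-≤ j l)

  insertAt-fixed-isLastFixed : IsLastFixed (insertAt j j x) j
  insertAt-fixed-isLastFixed = (1≤j , m≤n⇒m≤1+n j≤n , xⱼ≡j) , above
    where
    xⱼ≡j : insertAt j j x ! j ≡ j
    xⱼ≡j = trans (insertAt-fixed-! j) (trans (cong (x !_) (collapse-below ≤-refl)) (proj₂ (proj₂ fixed)))

    above : ∀ l → j < l → l ≤ suc n → insertAt j j x ! l ≢ l
    above (suc m) (s≤s j≤m) (s≤s m≤n) xₗ≡l = 1+n≰n (begin
      suc m                    ≡⟨ sym xₗ≡l ⟩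
      insertAt j j x ! suc m   ≡⟨ insertAt-fixed-! (suc m) ⟩
      x ! collapse j (suc m)   ≡⟨ cong (x !_) (collapse-above j≤m) ⟩
      x ! m                    ≤⟨ x≤id m (≤-trans 1≤j j≤m) m≤n ⟩
      m                        ∎)
      where open ≤-Reasoning

  insertAt-fixed-last : insertAt j j x ! suc n ≡ x ! n
  insertAt-fixed-last = trans (insertAt-fixed-! (suc n)) (cong (x !_) (collapse-above j≤n))

ψ⁻¹ : ∀ {n} → Vec ℕ n × ℕ → Vec ℕ (suc n)
ψ⁻¹ (x' , j) = insertAt j j x'

module _ {n k} (k≤n : k ≤ n) (x : Vec ℕ (suc n)) (dom : InDom n k x) where

  private
    ndpf : IsNDPF x
    ndpf = proj₁ dom

    last : IsLastFixed x (maxFix x)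
    last = proj₁ (inDom-lastFixed x k≤n dom)

    i≤n : maxFix x ≤ n
    i≤n = proj₂ (inDom-lastFixed x k≤n dom)

    1≤i : 1 ≤ maxFix x
    1≤i = proj₁ (proj₁ last)

  ψ-isFixed : ∀ j → IsFixed x j ⇔ (IsFixed (proj₁ (ψ x)) j × j ≤ maxFix x)
  ψ-isFixed = deleteAt-lastFixed-isFixed x ndpf last i≤n

  ψ-into : InCod n k (ψ x)
  ψ-into = deleteAt-lastFixed-isNDPF x ndpf last , i-fixed , subst (_≤ k) (sym x'ₙ≡xₙ₊₁) (proj₂ dom)
    where
    i-fixed : IsFixed (deleteAt (maxFix x) x) (maxFix x)
    i-fixed = proj₁ (Equivalence.to (ψ-isFixed (maxFix x)) (proj₁ last))

    x'ₙ≡xₙ₊₁ : deleteAt (maxFix x) x ! n ≡ x ! suc n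
    x'ₙ≡xₙ₊₁ = trans (deleteAt-! (maxFix x) x n (≤-trans 1≤i i≤n) ≤-refl) (cong (x !_) (punchIn-above i≤n))

  ψ⁻¹-ψ : ψ⁻¹ (ψ x) ≡ x
  ψ⁻¹-ψ = begin
    insertAt i i (deleteAt i x)        ≡⟨ cong (λ v → insertAt i v (deleteAt i x)) (sym (proj₂ (proj₂ (proj₁ last)))) ⟩
    insertAt i (x ! i) (deleteAt i x)  ≡⟨ insertAt-deleteAt i x 1≤i (m≤n⇒m≤1+n i≤n) ⟩
    x                                  ∎
    where
    open ≡-Reasoning
    i : ℕ
    i = maxFix x

ψ⁻¹-into : ∀ {n k} c → InCod n k c → InDom n k (ψ⁻¹ c)
ψ⁻¹-into {k = k} (x' , j) (ndpf , fixed , x'ₙ≤k) =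
  insertAt-fixed-isNDPF x' ndpf fixed , subst (_≤ k) (sym (insertAt-fixed-last x' ndpf fixed)) x'ₙ≤k

ψ-ψ⁻¹ : ∀ {n k} c → InCod n k c → ψ (ψ⁻¹ c) ≡ c
ψ-ψ⁻¹ (x' , j) (ndpf , fixed , _) = begin
  ψ (insertAt j j x')                ≡⟨ cong (λ i → deleteAt i (insertAt j j x') , i) maxFix≡j ⟩
  deleteAt j (insertAt j j x') , j   ≡⟨ cong (_, j) (deleteAt-insertAt j j x') ⟩
  x' , j                             ∎
  where
  open ≡-Reasoning
  maxFix≡j : maxFix (insertAt j j x') ≡ j
  maxFix≡j = isLastFixed⇒maxFix≡ (insertAt j j x') (insertAt-fixed-isLastFixed x' ndpf fixed)

ψ-injective : ∀ {n k} → k ≤ n → ∀ x y → InDom n k x → InDom n k y → ψ x ≡ ψ y → x ≡ y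
ψ-injective k≤n x y x∈dom y∈dom ψx≡ψy = begin
  x           ≡⟨ sym (ψ⁻¹-ψ k≤n x x∈dom) ⟩
  ψ⁻¹ (ψ x)   ≡⟨ cong ψ⁻¹ ψx≡ψy ⟩
  ψ⁻¹ (ψ y)   ≡⟨ ψ⁻¹-ψ k≤n y y∈dom ⟩
  y           ∎
  where open ≡-Reasoning

lemma4p11 : ∀ (n k : ℕ) → 1 ≤ k → k ≤ n →
    (∀ (x : Vec ℕ (suc n)) → InDom n k x → InCod n k (ψ x)) ×
    (∀ (x y : Vec ℕ (suc n)) → InDom n k x → InDom n k y → ψ x ≡ ψ y → x ≡ y) ×
    (∀ (x' : Vec ℕ n) (j : ℕ) → InCod n k (x' , j) →
      Σ (Vec ℕ (suc n)) (λ x → InDom n k x × (ψ x ≡ (x' , j)))) ×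
    (∀ (x : Vec ℕ (suc n)) → InDom n k x → ∀ (j : ℕ) →
      (IsFixed x j → IsFixed (proj₁ (ψ x)) j × (j ≤ maxFix x)) ×
      (IsFixed (proj₁ (ψ x)) j × (j ≤ maxFix x) → IsFixed x j))
lemma4p11 n k _ k≤n =
  ψ-into k≤n ,
  ψ-injective k≤n ,
  (λ x' j cod → ψ⁻¹ (x' , j) , ψ⁻¹-into (x' , j) cod , ψ-ψ⁻¹ (x' , j) cod) ,
  (λ x dom j → Equivalence.to (ψ-isFixed k≤n x dom j) , Equivalence.from (ψ-isFixed k≤n x dom j))
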